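{- For every integer $n\geq 0$, \[ \sum_{k=0}^{n}(-1)^{n-k}\binom{n}{k}P_k(x)(1+x)^{n-k}=\begin{cases} x^r\binom{2r}{r}, & \text{if } n=2r,\\ 0, & \text{if } n \text{ is odd}.\end{cases} \]
   Context: For $k\geq 0$, $P_k(x)=\sum_{j=0}^{k}\binom{k}{j}^2x^j$ denotes the type $B$ Narayana polynomial (so $P_0(x)=1$). -}

module Defs where

open import Level using (Level)
open import Data.Nat using (ℕ; zero; suc; _∸_)
import Data.Nat as ℕ
open import Data.Nat.Combinatorics using (_C_)
open import Algebra.Bundles using (CommutativeRing)

-- All definitions are relative to an arbitrary commutative ring R;
-- x ranges over R (polynomial identity with integer coefficients).
module InRing {c ℓ : Level} (R : CommutativeRing c ℓ) where
  open CommutativeRing R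

  ι : ℕ → Carrier
  ι zero    = 0#
  ι (suc n) = 1# + ι n

  pow : Carrier → ℕ → Carrier
  pow x zero    = 1#
  pow x (suc n) = x * pow x n

  sumTo : ℕ → (ℕ → Carrier) → Carrier
  sumTo zero    f = f 0
  sumTo (suc n) f = sumTo n f + f (suc n)

  P : ℕ → Carrier → Carrier
  P k x = sumTo k (λ j → ι ((k C j) ℕ.* (k C j)) * pow x j)

  LHS : ℕ → Carrier → Carrier
  LHS n x = sumTo n (λ k → pow (- 1#) (n ∸ k) * ι (n C k) * P k x * pow (1# + x) (n ∸ k))

  Identity : Carrier → ℕ → Set ℓ
  Identity x r = (LHS (2 ℕ.* r) x ≈ pow x r * ι ((2 ℕ.* r) C r))
               × (LHS (suc (2 ℕ.* r)) x ≈ 0#)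
    where open import Data.Product using (_×_)

module Submission where

-- Work with coefficient sequences ℤ → R, read as Laurent polynomials
-- Σ_d f(d) tᵈ, and put y = 1 + x and w = t + x t⁻¹.  Since
--   (1 + t)ᵏ (1 + x t⁻¹)ᵏ = (y + w)ᵏ,
-- the constant term of both sides gives P_k(x) = Σ_m C(k,m) y^(k-m) c_m,
-- where c_m = [t⁰] wᵐ = Σ_j C(m,j) xʲ [m = 2j].  In the language of the
-- binomial transform  T_a f n = Σ_k C(n,k) a^(n-k) f(k)  this reads
-- P = T_y c, and the left-hand side of the theorem is T_(-y) P.  As
-- T_a ∘ T_b = T_(a+b) and T_0 = id, the left-hand side equals c_n, which
-- is x^r C(2r,r) for n = 2r and 0 for n odd.

open import Defs
open import Level using (Level)
open import Data.Nat using (ℕ)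
open import Algebra.Bundles using (CommutativeRing)

open import Data.Nat as ℕ using (zero; suc; _≤_; _∸_; z≤n; s≤s)
import Data.Nat.Properties as ℕP
open import Data.Nat.Combinatorics using (_C_; k>n⇒nCk≡0; nCk+nC[k+1]≡[n+1]C[k+1])
open import Data.Integer as ℤ using (ℤ; +_; -[1+_])
import Data.Integer.Properties as ℤP
open import Data.Integer.Tactic.RingSolver using (solve-∀)
open import Data.Product using (_,_)
open import Data.Sum using (inj₁; inj₂)
open import Data.Empty using (⊥-elim)
open import Relation.Binary.PropositionalEquality as ≡ using (_≡_; _≢_)

-- Binomial coefficient C(a, z) with an integer lower index, zero for
-- negative z, so that Pascal's rule holds for every integer z.
_Cℤ_ : ℕ → ℤ → ℕ
a Cℤ (+ k)    = a C k
a Cℤ -[1+ _ ] = 0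

pascalℤ : ∀ a z → suc a Cℤ z ≡ a Cℤ z ℕ.+ a Cℤ (z ℤ.- + 1)
pascalℤ a (+ zero)  = ≡.refl
pascalℤ a (+ suc k) = ≡.trans (≡.sym (nCk+nC[k+1]≡[n+1]C[k+1] a k)) (ℕP.+-comm (a C k) (a C suc k))
pascalℤ a -[1+ _ ]  = ≡.refl

-- Index bookkeeping for the exponents of t in the recurrences below; all
-- are ring identities in ℤ.  A successor index + suc m is written + 1 + + m,
-- which is definitionally the same integer.
lower-shift : ∀ i d → (i ℤ.+ d) ℤ.- + 1 ≡ i ℤ.+ (d ℤ.- + 1)
lower-shift = solve-∀

raise-shift : ∀ i d → (+ 1 ℤ.+ i) ℤ.+ d ≡ i ℤ.+ (d ℤ.+ + 1)
raise-shift = solve-∀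

shift-cancel : ∀ d → (d ℤ.- + 1) ℤ.+ + 1 ≡ d
shift-cancel = solve-∀

exponent-lower : ∀ m i d → ((+ 1 ℤ.+ m) ℤ.- i) ℤ.- d ≡ (m ℤ.- i) ℤ.- (d ℤ.- + 1)
exponent-lower = solve-∀

exponent-raise : ∀ m i d → ((+ 1 ℤ.+ m) ℤ.- (+ 2 ℤ.+ i)) ℤ.- d ≡ (m ℤ.- i) ℤ.- (d ℤ.+ + 1)
exponent-raise = solve-∀

exponent-zero⇒equal : ∀ n i → (+ n ℤ.- + i) ℤ.- + 0 ≡ + 0 → n ≡ i
exponent-zero⇒equal n i e =
  ℤP.+-injective (ℤP.i-j≡0⇒i≡j (+ n) (+ i) (≡.trans (≡.sym (ℤP.+-identityʳ _)) e))

exponent-self : ∀ n → (+ n ℤ.- + n) ℤ.- + 0 ≡ + 0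
exponent-self n = ≡.trans (ℤP.+-identityʳ _) (ℤP.+-inverseʳ (+ n))

module Development {c ℓ : Level} (R : CommutativeRing c ℓ) where
  open CommutativeRing R hiding (zero)
  open InRing R
  open import Relation.Binary.Reasoning.Setoid setoid
  open import Algebra.Properties.Ring ring using (-1*x≈-x)
  open import Algebra.Solver.Ring.NaturalCoefficients.Default commutativeSemiring
    using (solve; _:=_; _:+_; _:*_)

  ≡⇒≈ : ∀ {a b : Carrier} → a ≡ b → a ≈ b
  ≡⇒≈ ≡.refl = refl

  ι-+ : ∀ m n → ι (m ℕ.+ n) ≈ ι m + ι n
  ι-+ zero    n = sym (+-identityˡ _)
  ι-+ (suc m) n = trans (+-congˡ (ι-+ m n)) (sym (+-assoc _ _ _))

  ι-* : ∀ m n → ι (m ℕ.* n) ≈ ι m * ι n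
  ι-* zero    n = sym (zeroˡ _)
  ι-* (suc m) n = begin
    ι (n ℕ.+ m ℕ.* n)      ≈⟨ trans (ι-+ n (m ℕ.* n)) (+-congˡ (ι-* m n)) ⟩
    ι n + ι m * ι n        ≈⟨ +-congʳ (sym (*-identityˡ _)) ⟩
    1# * ι n + ι m * ι n   ≈⟨ sym (distribʳ _ _ _) ⟩
    (1# + ι m) * ι n       ∎

  ι-1 : ι 1 ≈ 1#
  ι-1 = +-identityʳ 1#

  pow-distrib : ∀ a b m → pow (a * b) m ≈ pow a m * pow b m
  pow-distrib a b zero    = sym (*-identityˡ 1#)
  pow-distrib a b (suc m) = trans (*-congˡ (pow-distrib a b m))
    (solve 4 (λ a b p q → (a :* b) :* (p :* q) := (a :* p) :* (b :* q)) refl a b (pow a m) (pow b m))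

  pow-sign : ∀ a m → pow (- 1#) m * pow a m ≈ pow (- a) m
  pow-sign a m = trans (sym (pow-distrib (- 1#) a m)) (pow-cong m (-1*x≈-x a))
    where
    pow-cong : ∀ m {u v} → u ≈ v → pow u m ≈ pow v m
    pow-cong zero    e = refl
    pow-cong (suc m) e = *-cong e (pow-cong m e)

  vanishing-factor : ∀ a b z → z ≈ 0# → a * (b * z) ≈ 0#
  vanishing-factor a b z e = trans (*-congˡ (trans (*-congˡ e) (zeroʳ b))) (zeroʳ a)

  sumTo-cong : ∀ n {f g : ℕ → Carrier} → (∀ i → i ≤ n → f i ≈ g i) → sumTo n f ≈ sumTo n g
  sumTo-cong zero    h = h 0 z≤n
  sumTo-cong (suc n) h = +-cong (sumTo-cong n (λ i i≤n → h i (ℕP.m≤n⇒m≤1+n i≤n))) (h (suc n) ℕP.≤-refl)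

  sumTo-+ : ∀ n (f g : ℕ → Carrier) → sumTo n (λ i → f i + g i) ≈ sumTo n f + sumTo n g
  sumTo-+ zero    f g = refl
  sumTo-+ (suc n) f g = trans (+-congʳ (sumTo-+ n f g))
    (solve 4 (λ a b c d → (a :+ b) :+ (c :+ d) := (a :+ c) :+ (b :+ d)) refl _ _ _ _)

  sumTo-scale : ∀ n s (f : ℕ → Carrier) → sumTo n (λ i → s * f i) ≈ s * sumTo n f
  sumTo-scale zero    s f = refl
  sumTo-scale (suc n) s f = trans (+-congʳ (sumTo-scale n s f)) (sym (distribˡ _ _ _))

  sumTo-head : ∀ n (f : ℕ → Carrier) → sumTo (suc n) f ≈ f 0 + sumTo n (λ i → f (suc i))
  sumTo-head zero    f = refl
  sumTo-head (suc n) f = trans (+-congʳ (sumTo-head n f)) (+-assoc _ _ _)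

  sumTo-vanish : ∀ n (f : ℕ → Carrier) → (∀ i → i ≤ n → f i ≈ 0#) → sumTo n f ≈ 0#
  sumTo-vanish zero    f h = h 0 z≤n
  sumTo-vanish (suc n) f h =
    trans (+-cong (sumTo-vanish n f (λ i i≤n → h i (ℕP.m≤n⇒m≤1+n i≤n))) (h (suc n) ℕP.≤-refl))
          (+-identityʳ 0#)

  sumTo-single : ∀ n r (f : ℕ → Carrier) → r ≤ n → (∀ i → i ≢ r → f i ≈ 0#) → sumTo n f ≈ f r
  sumTo-single zero    .zero f z≤n h = refl
  sumTo-single (suc n) r    f r≤  h with ℕP.m≤n⇒m<n∨m≡n r≤
  ... | inj₁ r<n+1 = trans (+-cong (sumTo-single n r f (ℕP.≤-pred r<n+1) h)
                                    (h (suc n) (λ e → ℕP.<-irrefl (≡.sym e) r<n+1)))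
                           (+-identityʳ _)
  ... | inj₂ ≡.refl = trans (+-congʳ (sumTo-vanish n f (λ i i≤n → h i (λ e → ℕP.<-irrefl e (s≤s i≤n)))))
                            (+-identityˡ _)

  sumTo-pascal : ∀ m (g : ℕ → Carrier) →
    sumTo (suc m) (λ i → ι (suc m C i) * g i)
      ≈ sumTo m (λ i → ι (m C i) * g i) + sumTo m (λ i → ι (m C i) * g (suc i))
  sumTo-pascal m g = begin
    sumTo (suc m) (λ i → ι (suc m C i) * g i)
      ≈⟨ sumTo-head m _ ⟩
    ι 1 * g 0 + sumTo m (λ i → ι (suc m C suc i) * g (suc i))
      ≈⟨ +-congˡ (trans (sumTo-cong m (λ i _ → split i)) (sumTo-+ m _ _)) ⟩
    ι 1 * g 0 + (sumTo m (λ i → ι (m C suc i) * g (suc i)) + B)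
      ≈⟨ sym (+-assoc _ _ _) ⟩
    (ι 1 * g 0 + sumTo m (λ i → ι (m C suc i) * g (suc i))) + B
      ≈⟨ +-congʳ (sym (sumTo-head m _)) ⟩
    sumTo (suc m) (λ i → ι (m C i) * g i) + B
      ≈⟨ +-congʳ (+-congˡ (trans (*-congʳ top-vanishes) (zeroˡ _))) ⟩
    (A + 0#) + B
      ≈⟨ +-congʳ (+-identityʳ A) ⟩
    A + B ∎
    where
    A = sumTo m (λ i → ι (m C i) * g i)
    B = sumTo m (λ i → ι (m C i) * g (suc i))
    top-vanishes : ι (m C suc m) ≈ 0#
    top-vanishes = ≡⇒≈ (≡.cong ι (k>n⇒nCk≡0 (ℕP.n<1+n m)))
    split : ∀ i → ι (suc m C suc i) * g (suc i) ≈ ι (m C suc i) * g (suc i) + ι (m C i) * g (suc i)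
    split i = trans (*-congʳ (trans (≡⇒≈ (≡.cong ι (pascalℤ m (+ suc i)))) (ι-+ (m C suc i) (m C i)))) (distribʳ _ _ _)

  -- The binomial transform T_a f n = Σ_k C(n,k) a^(n-k) f(k), defined by its
  -- recurrence T_a f (n+1) = a T_a f n + T_a (f ∘ suc) n.
  transform : Carrier → (ℕ → Carrier) → ℕ → Carrier
  transform a f zero    = f 0
  transform a f (suc n) = a * transform a f n + transform a (λ k → f (suc k)) n

  transform-cong : ∀ a n {f g : ℕ → Carrier} → (∀ k → f k ≈ g k) → transform a f n ≈ transform a g n
  transform-cong a zero    h = h 0
  transform-cong a (suc n) h = +-cong (*-congˡ (transform-cong a n h)) (transform-cong a n (λ k → h (suc k)))

  transform-congᵃ : ∀ {a b} n (f : ℕ → Carrier) → a ≈ b → transform a f n ≈ transform b f n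
  transform-congᵃ zero    f e = refl
  transform-congᵃ (suc n) f e = +-cong (*-cong e (transform-congᵃ n f e)) (transform-congᵃ n _ e)

  transform-+ : ∀ a n (f g : ℕ → Carrier) →
    transform a (λ k → f k + g k) n ≈ transform a f n + transform a g n
  transform-+ a zero    f g = refl
  transform-+ a (suc n) f g = trans (+-cong (*-congˡ (transform-+ a n f g)) (transform-+ a n _ _))
    (solve 5 (λ a p q r s → a :* (p :+ q) :+ (r :+ s) := (a :* p :+ r) :+ (a :* q :+ s)) refl a _ _ _ _)

  transform-scale : ∀ a n s (f : ℕ → Carrier) → transform a (λ k → s * f k) n ≈ s * transform a f n
  transform-scale a zero    s f = refl
  transform-scale a (suc n) s f = trans (+-cong (*-congˡ (transform-scale a n s f)) (transform-scale a n s _))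
    (solve 4 (λ a s p q → a :* (s :* p) :+ s :* q := s :* (a :* p :+ q)) refl a s _ _)

  transform-compose : ∀ a b n (f : ℕ → Carrier) →
    transform a (λ k → transform b f k) n ≈ transform (a + b) f n
  transform-compose a b zero    f = refl
  transform-compose a b (suc n) f = begin
    a * transform a (transform b f) n + transform a (λ k → b * transform b f k + transform b f′ k) n
      ≈⟨ +-congˡ (trans (transform-+ a n _ _) (+-congʳ (transform-scale a n b _))) ⟩
    a * transform a (transform b f) n + (b * transform a (transform b f) n + transform a (transform b f′) n)
      ≈⟨ +-cong (*-congˡ (transform-compose a b n f))
                (+-cong (*-congˡ (transform-compose a b n f)) (transform-compose a b n f′)) ⟩
    a * X + (b * X + Y)
      ≈⟨ solve 4 (λ a b X Y → a :* X :+ (b :* X :+ Y) := (a :+ b) :* X :+ Y) refl a b X Y ⟩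
    (a + b) * X + Y ∎
    where
    f′ : ℕ → Carrier
    f′ k = f (suc k)
    X = transform (a + b) f n
    Y = transform (a + b) f′ n

  transform-zero : ∀ n (f : ℕ → Carrier) → transform 0# f n ≈ f n
  transform-zero zero    f = refl
  transform-zero (suc n) f = trans (+-cong (zeroˡ _) (transform-zero n _)) (+-identityˡ _)

  transform-closed : ∀ a n (f : ℕ → Carrier) →
    transform a f n ≈ sumTo n (λ k → ι (n C k) * (pow a (n ∸ k) * f k))
  transform-closed a zero    f = sym (trans (*-cong ι-1 (*-identityˡ _)) (*-identityˡ _))
  transform-closed a (suc n) f = begin
    a * transform a f n + transform a (λ k → f (suc k)) n
      ≈⟨ +-cong (*-congˡ (transform-closed a n f)) (transform-closed a n _) ⟩
    a * sumTo n (λ k → ι (n C k) * (pow a (n ∸ k) * f k)) + sumTo n (λ k → ι (n C k) * (pow a (n ∸ k) * f (suc k)))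
      ≈⟨ +-congʳ (sym (trans (sumTo-cong n raise-exponent) (sumTo-scale n a _))) ⟩
    sumTo n (λ k → ι (n C k) * (pow a (suc n ∸ k) * f k)) + sumTo n (λ k → ι (n C k) * (pow a (n ∸ k) * f (suc k)))
      ≈⟨ sym (sumTo-pascal n (λ k → pow a (suc n ∸ k) * f k)) ⟩
    sumTo (suc n) (λ k → ι (suc n C k) * (pow a (suc n ∸ k) * f k)) ∎
    where
    raise-exponent : ∀ k → k ≤ n →
      ι (n C k) * (pow a (suc n ∸ k) * f k) ≈ a * (ι (n C k) * (pow a (n ∸ k) * f k))
    raise-exponent k k≤n = trans (*-congˡ (*-congʳ (≡⇒≈ (≡.cong (pow a) (ℕP.+-∸-assoc 1 k≤n)))))
      (solve 4 (λ c a p q → c :* ((a :* p) :* q) := a :* (c :* (p :* q))) refl _ a _ _)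

  -- The Kronecker delta at 0; as a coefficient sequence it is the Laurent
  -- polynomial 1.
  δ : ℤ → Carrier
  δ (+ zero)   = 1#
  δ (+ suc _)  = 0#
  δ -[1+ _ ]   = 0#

  δ-neg : ∀ z → δ (ℤ.- z) ≈ δ z
  δ-neg (+ zero)  = refl
  δ-neg (+ suc _) = refl
  δ-neg -[1+ _ ]  = refl

  δ-off : ∀ z → z ≢ + 0 → δ z ≈ 0#
  δ-off (+ zero)  z≢0 = ⊥-elim (z≢0 ≡.refl)
  δ-off (+ suc _) _   = refl
  δ-off -[1+ _ ]  _   = refl

  ι-0Cℤ : ∀ z → ι (0 Cℤ z) ≈ δ z
  ι-0Cℤ (+ zero)  = ι-1
  ι-0Cℤ (+ suc k) = ≡⇒≈ (≡.cong ι (k>n⇒nCk≡0 {0} {suc k} (s≤s z≤n)))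
  ι-0Cℤ -[1+ _ ]  = refl

  module AtPoint (x : Carrier) where

    y : Carrier
    y = 1# + x

    -- Multiplication of Σ_d f(d) tᵈ by w = t + x t⁻¹, on coefficients.
    wmul : (ℤ → Carrier) → ℤ → Carrier
    wmul f d = f (d ℤ.- + 1) + x * f (d ℤ.+ + 1)

    wmul-cong : ∀ {f g : ℤ → Carrier} → (∀ e → f e ≈ g e) → ∀ d → wmul f d ≈ wmul g d
    wmul-cong h d = +-cong (h _) (*-congˡ (h _))

    -- central m d = [tᵈ] wᵐ = Σ_j C(m,j) xʲ [m - 2j = d].
    central : ℕ → ℤ → Carrier
    central m d = sumTo m (λ j → ι (m C j) * (pow x j * δ ((+ m ℤ.- + (2 ℕ.* j)) ℤ.- d)))

    central-zero : ∀ d → central 0 d ≈ δ d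
    central-zero d = begin
      ι 1 * (1# * δ (+ 0 ℤ.- d)) ≈⟨ trans (*-cong ι-1 (*-identityˡ _)) (*-identityˡ _) ⟩
      δ (+ 0 ℤ.- d)              ≈⟨ ≡⇒≈ (≡.cong δ (ℤP.+-identityˡ (ℤ.- d))) ⟩
      δ (ℤ.- d)                  ≈⟨ δ-neg d ⟩
      δ d                        ∎

    central-suc : ∀ m d → central (suc m) d ≈ wmul (central m) d
    central-suc m d = trans (sumTo-pascal m (λ j → pow x j * δ ((+ suc m ℤ.- + (2 ℕ.* j)) ℤ.- d)))
      (+-cong (sumTo-cong m (λ j _ → lower j)) (trans (sumTo-cong m (λ j _ → raise j)) (sumTo-scale m x _)))
      where
      lower : ∀ j → ι (m C j) * (pow x j * δ ((+ suc m ℤ.- + (2 ℕ.* j)) ℤ.- d))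
                  ≈ ι (m C j) * (pow x j * δ ((+ m ℤ.- + (2 ℕ.* j)) ℤ.- (d ℤ.- + 1)))
      lower j = *-congˡ (*-congˡ (≡⇒≈ (≡.cong δ (exponent-lower (+ m) (+ (2 ℕ.* j)) d))))
      raise : ∀ j → ι (m C j) * (pow x (suc j) * δ ((+ suc m ℤ.- + (2 ℕ.* suc j)) ℤ.- d))
                  ≈ x * (ι (m C j) * (pow x j * δ ((+ m ℤ.- + (2 ℕ.* j)) ℤ.- (d ℤ.+ + 1))))
      raise j = trans (*-congˡ (*-congˡ (≡⇒≈ (≡.cong δ (≡.trans
                  (≡.cong (λ i → (+ suc m ℤ.- + i) ℤ.- d) (ℕP.*-suc 2 j))
                  (exponent-raise (+ m) (+ (2 ℕ.* j)) d))))))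
        (solve 4 (λ c x p q → c :* ((x :* p) :* q) := x :* (c :* (p :* q))) refl _ x _ _)

    -- mixed a b d = [tᵈ] (1 + t)ᵃ (1 + x t⁻¹)ᵇ = Σ_j C(b,j) C(a,j+d) xʲ.
    mixed : ℕ → ℕ → ℤ → Carrier
    mixed a b d = sumTo b (λ j → ι (b C j) * (ι (a Cℤ (+ j ℤ.+ d)) * pow x j))

    mixed-sucˡ : ∀ a b d → mixed (suc a) b d ≈ mixed a b d + mixed a b (d ℤ.- + 1)
    mixed-sucˡ a b d = trans (sumTo-cong b (λ j _ → split j)) (sumTo-+ b _ _)
      where
      split : ∀ j → ι (b C j) * (ι (suc a Cℤ (+ j ℤ.+ d)) * pow x j)
                  ≈ ι (b C j) * (ι (a Cℤ (+ j ℤ.+ d)) * pow x j)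
                    + ι (b C j) * (ι (a Cℤ (+ j ℤ.+ (d ℤ.- + 1))) * pow x j)
      split j = begin
        ι (b C j) * (ι (suc a Cℤ (+ j ℤ.+ d)) * pow x j)
          ≈⟨ *-congˡ (*-congʳ (trans (≡⇒≈ (≡.cong ι (pascalℤ a (+ j ℤ.+ d)))) (ι-+ (a Cℤ (+ j ℤ.+ d)) _))) ⟩
        ι (b C j) * ((ι (a Cℤ (+ j ℤ.+ d)) + ι (a Cℤ ((+ j ℤ.+ d) ℤ.- + 1))) * pow x j)
          ≈⟨ trans (*-congˡ (distribʳ _ _ _)) (distribˡ _ _ _) ⟩
        ι (b C j) * (ι (a Cℤ (+ j ℤ.+ d)) * pow x j) + ι (b C j) * (ι (a Cℤ ((+ j ℤ.+ d) ℤ.- + 1)) * pow x j)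
          ≈⟨ +-congˡ (≡⇒≈ (≡.cong (λ z → ι (b C j) * (ι (a Cℤ z) * pow x j)) (lower-shift (+ j) d))) ⟩
        ι (b C j) * (ι (a Cℤ (+ j ℤ.+ d)) * pow x j) + ι (b C j) * (ι (a Cℤ (+ j ℤ.+ (d ℤ.- + 1))) * pow x j) ∎

    mixed-sucʳ : ∀ a b d → mixed a (suc b) d ≈ mixed a b d + x * mixed a b (d ℤ.+ + 1)
    mixed-sucʳ a b d = trans (sumTo-pascal b (λ j → ι (a Cℤ (+ j ℤ.+ d)) * pow x j))
      (+-congˡ (trans (sumTo-cong b (λ j _ → raise j)) (sumTo-scale b x _)))
      where
      raise : ∀ j → ι (b C j) * (ι (a Cℤ (+ suc j ℤ.+ d)) * pow x (suc j))
                  ≈ x * (ι (b C j) * (ι (a Cℤ (+ j ℤ.+ (d ℤ.+ + 1))) * pow x j))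
      raise j = trans (*-congˡ (*-congʳ (≡⇒≈ (≡.cong (λ z → ι (a Cℤ z)) (raise-shift (+ j) d)))))
        (solve 4 (λ c u x p → c :* (u :* (x :* p)) := x :* (c :* (u :* p))) refl _ _ x _)

    -- On the diagonal: (1 + t)(1 + x t⁻¹) = y + w.
    diagonal-suc : ∀ k d → mixed (suc k) (suc k) d ≈ y * mixed k k d + wmul (mixed k k) d
    diagonal-suc k d = begin
      mixed (suc k) (suc k) d
        ≈⟨ trans (mixed-sucˡ k (suc k) d) (+-cong (mixed-sucʳ k k d) (mixed-sucʳ k k (d ℤ.- + 1))) ⟩
      (M d + x * M (d ℤ.+ + 1)) + (M (d ℤ.- + 1) + x * M ((d ℤ.- + 1) ℤ.+ + 1))
        ≈⟨ +-congˡ (+-congˡ (*-congˡ (≡⇒≈ (≡.cong M (shift-cancel d))))) ⟩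
      (M d + x * M (d ℤ.+ + 1)) + (M (d ℤ.- + 1) + x * M d)
        ≈⟨ solve 4 (λ x m u l → (m :+ x :* u) :+ (l :+ x :* m) := (m :+ x :* m) :+ (l :+ x :* u)) refl x (M d) _ _ ⟩
      (M d + x * M d) + wmul M d
        ≈⟨ +-congʳ (sym (trans (distribʳ _ _ _) (+-congʳ (*-identityˡ _)))) ⟩
      y * M d + wmul M d ∎
      where
      M : ℤ → Carrier
      M = mixed k k

    P-as-mixed : ∀ k → P k x ≈ mixed k k (+ 0)
    P-as-mixed k = sumTo-cong k (λ j _ → begin
      ι ((k C j) ℕ.* (k C j)) * pow x j
        ≈⟨ trans (*-congʳ (ι-* (k C j) (k C j))) (*-assoc _ _ _) ⟩
      ι (k C j) * (ι (k C j) * pow x j)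
        ≈⟨ *-congˡ (*-congʳ (≡⇒≈ (≡.cong (λ z → ι (k Cℤ z)) (≡.sym (ℤP.+-identityʳ (+ j)))))) ⟩
      ι (k C j) * (ι (k Cℤ (+ j ℤ.+ + 0)) * pow x j) ∎)

    -- Binomial theorem for y + w: if u m = wᵐ · u 0 coefficientwise, then the
    -- transform T_y u obeys the recurrence of (y + w)ᵏ · u 0.
    transform-wmul : ∀ (u : ℕ → ℤ → Carrier) → (∀ m d → u (suc m) d ≈ wmul (u m) d) →
      ∀ k d → transform y (λ m → u m d) (suc k)
              ≈ y * transform y (λ m → u m d) k + wmul (λ e → transform y (λ m → u m e) k) d
    transform-wmul u u-suc k d = +-congˡ (begin
      transform y (λ m → u (suc m) d) k
        ≈⟨ transform-cong y k (λ m → u-suc m d) ⟩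
      transform y (λ m → u m (d ℤ.- + 1) + x * u m (d ℤ.+ + 1)) k
        ≈⟨ trans (transform-+ y k _ _) (+-congˡ (transform-scale y k x _)) ⟩
      wmul (λ e → transform y (λ m → u m e) k) d ∎)

    mixed-as-transform : ∀ k d → mixed k k d ≈ transform y (λ m → central m d) k
    mixed-as-transform zero    d = trans (trans (*-cong ι-1 (*-identityʳ _)) (*-identityˡ _))
      (trans (≡⇒≈ (≡.cong (λ z → ι (0 Cℤ z)) (ℤP.+-identityˡ d))) (trans (ι-0Cℤ d) (sym (central-zero d))))
    mixed-as-transform (suc k) d = begin
      mixed (suc k) (suc k) d
        ≈⟨ diagonal-suc k d ⟩
      y * mixed k k d + wmul (mixed k k) d
        ≈⟨ +-cong (*-congˡ (mixed-as-transform k d)) (wmul-cong (mixed-as-transform k) d) ⟩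
      y * transform y (λ m → central m d) k + wmul (λ e → transform y (λ m → central m e) k) d
        ≈⟨ sym (transform-wmul central central-suc k d) ⟩
      transform y (λ m → central m d) (suc k) ∎

    LHS-as-transform : ∀ n → LHS n x ≈ transform (- y) (λ k → P k x) n
    LHS-as-transform n = sym (trans (transform-closed (- y) n _) (sumTo-cong n (λ k _ → sym (rearrange k))))
      where
      rearrange : ∀ k → pow (- 1#) (n ∸ k) * ι (n C k) * P k x * pow y (n ∸ k)
                        ≈ ι (n C k) * (pow (- y) (n ∸ k) * P k x)
      rearrange k = trans
        (solve 4 (λ s c p q → ((s :* c) :* p) :* q := c :* ((s :* q) :* p)) refl _ _ _ _)
        (*-congˡ (*-congʳ (pow-sign y (n ∸ k))))

    -- Inverting the transform: LHS n = [t⁰] wⁿ.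
    LHS-central : ∀ n → LHS n x ≈ central n (+ 0)
    LHS-central n = begin
      LHS n x
        ≈⟨ LHS-as-transform n ⟩
      transform (- y) (λ k → P k x) n
        ≈⟨ transform-cong (- y) n (λ k → trans (P-as-mixed k) (mixed-as-transform k (+ 0))) ⟩
      transform (- y) (λ k → transform y (λ m → central m (+ 0)) k) n
        ≈⟨ transform-compose (- y) y n _ ⟩
      transform (- y + y) (λ m → central m (+ 0)) n
        ≈⟨ trans (transform-congᵃ n _ (-‿inverseˡ y)) (transform-zero n _) ⟩
      central n (+ 0) ∎

    -- [t⁰] w²ʳ = C(2r,r) xʳ: only j = r contributes.
    central-even : ∀ r → central (2 ℕ.* r) (+ 0) ≈ pow x r * ι ((2 ℕ.* r) C r)
    central-even r = begin
      central (2 ℕ.* r) (+ 0)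
        ≈⟨ sumTo-single (2 ℕ.* r) r _ (ℕP.m≤n*m r 2) (λ j j≢r →
             vanishing-factor _ _ _ (δ-off _ (λ e → j≢r (ℕP.*-cancelˡ-≡ j r 2
               (≡.sym (exponent-zero⇒equal (2 ℕ.* r) (2 ℕ.* j) e)))))) ⟩
      ι ((2 ℕ.* r) C r) * (pow x r * δ ((+ (2 ℕ.* r) ℤ.- + (2 ℕ.* r)) ℤ.- + 0))
        ≈⟨ *-congˡ (*-congˡ (≡⇒≈ (≡.cong δ (exponent-self (2 ℕ.* r))))) ⟩
      ι ((2 ℕ.* r) C r) * (pow x r * 1#)
        ≈⟨ trans (*-congˡ (*-identityʳ _)) (*-comm _ _) ⟩
      pow x r * ι ((2 ℕ.* r) C r) ∎

    -- [t⁰] w²ʳ⁺¹ = 0: every exponent 2r + 1 - 2j is odd.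
    central-odd : ∀ r → central (suc (2 ℕ.* r)) (+ 0) ≈ 0#
    central-odd r = sumTo-vanish (suc (2 ℕ.* r)) _ (λ j _ →
      vanishing-factor _ _ _ (δ-off _ (λ e →
        ℕP.even≢odd j r (≡.sym (exponent-zero⇒equal (suc (2 ℕ.* r)) (2 ℕ.* j) e)))))

theorem3p1 : ∀ {c ℓ : Level} (R : CommutativeRing c ℓ) (x : CommutativeRing.Carrier R) (r : ℕ) →
    InRing.Identity R x r
theorem3p1 R x r =
    trans (LHS-central (2 ℕ.* r)) (central-even r)
  , trans (LHS-central (suc (2 ℕ.* r))) (central-odd r)
  where
  open Development R
  open AtPoint x
  open CommutativeRing R using (trans)
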